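{- Let $w_1,\dots,w_k\in\mathbb{Z}$ and $t\in\mathbb{Z}$. The threshold set $T=\{(x_1,\dots,x_k)\in\mathbb{N}^k : \sum_{i=1}^k w_ix_i\ge t\}$ is reverse-robustly decidable by a chemical reaction decider (CRD).
   Context: A CRN is a pair $(\Lambda,R)$ with $\Lambda$ finite and reactions $r=(\vec a,\vec p)\in\mathbb{N}^\Lambda\times\mathbb{N}^\Lambda$; its reverse is $(\vec p,\vec a)$. Reaction $r$ is applicable to $\vec x\in\mathbb{N}^\Lambda$ if $\vec x\geqq\vec a$, yielding $\vec x-\vec a+\vec p$. $\vec x\to\vec y$: $\vec y$ obtained by finitely many forward reaction applications; $\vec x\looparrowright\vec y$: obtained by finitely many applications of reactions and/or their reverses. A CRD is $(\Lambda,R,\Sigma,\Upsilon_1,\Upsilon_0,\vec s)$ with input species $\Sigma=\{X_1,\dots,X_k\}$, yes voters $\Upsilon_1$, no voters $\Upsilon_0$, initial context $\vec s\in\mathbb{N}^{\Lambda\setminus\Sigma}$. Valid initial configurations are $\vec s$ plus arbitrary counts of input species, with input $\vec i|\Sigma\in\mathbb{N}^k$. Output $\Phi(\vec c)=1$ if some yes voter has positive count and no no voter does, $0$ if some no voter has positive count and no yes voter does, undefined otherwise; $\vec o$ is stable if $\Phi(\vec o')=\Phi(\vec o)$ for all $\vec o\to\vec o'$. The CRD reverse-robustly decides $S\subseteq\mathbb{N}^k$ if for every valid initial configuration $\vec i$ and every $\vec c$ with $\vec i\looparrowright\vec c$ there is a stable $\vec o$ with $\vec c\to\vec o$ and $\Phi(\vec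 o)=1$ iff $\vec i|\Sigma\in S$. -}

module Defs where

open import Data.Nat using (ℕ; _≤_; _∸_; _+_)
open import Data.Integer as ℤ using (ℤ; +_)
open import Data.Fin using (Fin; zero; suc; splitAt)
open import Data.Bool using (Bool; true; false)
open import Data.List using (List)
open import Data.List.Membership.Propositional using (_∈_)
open import Data.Product using (Σ; ∃; ∃-syntax; _×_; _,_)
open import Data.Sum using (_⊎_; inj₁; inj₂)
open import Relation.Nullary using (¬_)
open import Relation.Binary.PropositionalEquality using (_≡_)
open import Relation.Binary.Construct.Closure.ReflexiveTransitive using (Star)

Config : ℕ → Set
Config n = Fin n → ℕ

record Reaction (n : ℕ) : Set where
  constructor rxn
  field
    reactants : Config n
    products  : Config n
open Reaction public

reverseR : ∀ {n} → Reaction n → Reaction n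
reverseR (rxn a p) = rxn p a

Applicable : ∀ {n} → Reaction n → Config n → Set
Applicable r x = ∀ i → reactants r i ≤ x i

apply : ∀ {n} → Reaction n → Config n → Config n
apply r x i = (x i ∸ reactants r i) + products r i

Step : ∀ {n} → List (Reaction n) → Config n → Config n → Set
Step R x y = Σ _ λ r → (r ∈ R) × Applicable r x × (y ≡ apply r x)

BiStep : ∀ {n} → List (Reaction n) → Config n → Config n → Set
BiStep R x y = Step R x y ⊎ Σ _ λ r → (r ∈ R) × Applicable (reverseR r) x × (y ≡ apply (reverseR r) x)

Reach : ∀ {n} → List (Reaction n) → Config n → Config n → Set
Reach R = Star (Step R)

BiReach : ∀ {n} → List (Reaction n) → Config n → Config n → Set
BiReach R = Star (BiStep R)

-- A chemical reaction decider with k input species.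
-- Species are Fin (k + m); the input species X_1..X_k are the first k,
-- the remaining m species are non-input species.
record CRD (k : ℕ) : Set where
  field
    m         : ℕ
    reactions : List (Reaction (k + m))
    yes       : Fin (k + m) → Bool
    no        : Fin (k + m) → Bool
    context   : Fin m → ℕ
open CRD public

Species : ∀ {k} → CRD k → Set
Species {k} D = Fin (k + m D)

-- Φ(c) = 1 / Φ(c) = 0, as a relation (Φ is partial).
Out : ∀ {k} (D : CRD k) → Config (k + m D) → Bool → Set
Out D c true  = (∃[ i ] (yes D i ≡ true × 0 Data.Nat.< c i)) × (∀ i → no D i ≡ true → c i ≡ 0)
Out D c false = (∃[ i ] (no D i ≡ true × 0 Data.Nat.< c i)) × (∀ i → yes D i ≡ true → c i ≡ 0)

StableOut : ∀ {k} (D : CRD k) → Config (k + m D) → Bool → Set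
StableOut D o b = ∀ o' → Reach (reactions D) o o' → Out D o' b

initial : ∀ {k} (D : CRD k) → (Fin k → ℕ) → Config (k + m D)
initial {k} D x i with splitAt k i
... | inj₁ j = x j
... | inj₂ j = context D j

ReverseRobustlyDecides : ∀ {k} → CRD k → ((Fin k → ℕ) → Set) → Set
ReverseRobustlyDecides D S =
  ∀ (x : Fin _ → ℕ) (c : Config _) → BiReach (reactions D) (initial D x) c →
    (S x → ∃[ o ] (Reach (reactions D) c o × StableOut D o true))
    × (¬ S x → ∃[ o ] (Reach (reactions D) c o × StableOut D o false))

ReverseRobustlyDecidable : (k : ℕ) → ((Fin k → ℕ) → Set) → Set
ReverseRobustlyDecidable k S = ∃[ D ] ReverseRobustlyDecides {k} D S

wsum : ∀ {k} → (Fin k → ℤ) → (Fin k → ℕ) → ℤ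
wsum {ℕ.zero} w x = + 0
wsum {ℕ.suc k} w x = w zero ℤ.* (+ x zero) ℤ.+ wsum (λ i → w (suc i)) (λ i → x (suc i))

Threshold : ∀ {k} → (Fin k → ℤ) → ℤ → (Fin k → ℕ) → Set
Threshold w t x = t ℤ.≤ wsum w x

-- Besides the inputs Xᵢ, the CRD has a leader that is either Lʸ (the yes voter) or Lⁿ (the
-- no voter), and positive and negative units Pos, Neg. Each Xᵢ turns into ∣wᵢ∣ units of the
-- sign of wᵢ, and the leader switches its vote by absorbing a unit of the opposite sign:
-- Lʸ + Neg → Lⁿ and Lⁿ + Pos → Lʸ. The initial context is Lʸ plus ∣t∣ units of the sign of −t.
--
-- Every reaction, used forwards or backwards, preserves the number of leaders Lʸ + Lⁿ and the
-- value Σ wᵢXᵢ + Pos − Lⁿ − Neg, so on every configuration reachable in the reverse-robust sense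
-- these are 1 and Σ wᵢxᵢ − t. Forward reactions strictly decrease the potential
-- Σ (1 + ∣wᵢ∣)Xᵢ + Pos + Neg, so from any configuration a terminal one is reachable, and terminal
-- configurations are stable. In a terminal configuration no Xᵢ is left, Lʸ excludes Neg and Lⁿ
-- excludes Pos; hence the value is Pos ≥ 0 if the leader is Lʸ and −1 − Neg < 0 if it is Lⁿ.
module Submission where

open import Defs
open import Data.Bool using (Bool; true; false)
open import Data.Empty using (⊥-elim)
open import Data.Fin using (Fin; zero; suc; _↑ˡ_; _↑ʳ_; splitAt)
open import Data.Fin.Properties using (_≟_; all?; splitAt⁻¹-↑ˡ; splitAt⁻¹-↑ʳ)
open import Data.Integer as ℤ using (ℤ; +_; -[1+_]; ∣_∣; 0ℤ; 1ℤ; -1ℤ; +≤+; +<+; -<+)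
import Data.Integer.Properties as ℤ
open import Algebra.Properties.CommutativeSemigroup ℤ.+-commutativeSemigroup using (interchange)
open import Data.Integer.Tactic.RingSolver using (solve-∀)
open import Data.List as List using (List; _∷_; [])
open import Data.List.Membership.Propositional using (find)
open import Data.List.Relation.Unary.All as All using (All; _∷_; [])
open import Data.List.Relation.Unary.All.Properties
  using (¬Any⇒All¬; ++⁺; ++⁻ˡ; ++⁻ʳ; tabulate⁺; tabulate⁻)
open import Data.List.Relation.Unary.Any using (any?)
open import Data.Nat using (ℕ; zero; suc; _+_; _∸_; _≤_; _<_; _≤?_; z≤n; z<s)
open import Data.Nat.Induction using (<-wellFounded)
open import Data.Nat.Properties using (m∸n+n≡m; n<1+n; n≤0⇒n≡0; ≮⇒≥)
open import Data.Product using (∃-syntax; _×_; _,_)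
open import Data.Sum using (_⊎_; inj₁; inj₂)
open import Data.Vec.Functional using (_++_)
open import Data.Vec.Functional.Properties using (lookup-++ˡ; lookup-++ʳ)
open import Function using (_∘_; const)
open import Induction.WellFounded using (Acc; acc)
open import Relation.Binary.Construct.Closure.ReflexiveTransitive as Star using (ε; _◅_; _◅◅_)
open import Relation.Binary.PropositionalEquality
open import Relation.Nullary using (Dec; yes; no; ¬_; does; contradiction)
open import Relation.Nullary.Decidable using (dec-true)

wsum-cong : ∀ {n} {a a′ : Fin n → ℤ} {c c′ : Config n} → a ≗ a′ → c ≗ c′ → wsum a c ≡ wsum a′ c′
wsum-cong {zero}  _    _    = refl
wsum-cong {suc n} a≗a′ c≗c′ =
  cong₂ ℤ._+_ (cong₂ (λ u v → u ℤ.* + v) (a≗a′ zero) (c≗c′ zero))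
              (wsum-cong (a≗a′ ∘ suc) (c≗c′ ∘ suc))

wsum-+ : ∀ {n} (a : Fin n → ℤ) (c d : Config n) →
  wsum a (λ i → c i + d i) ≡ wsum a c ℤ.+ wsum a d
wsum-+ {zero}  a c d = refl
wsum-+ {suc n} a c d = trans
  (cong₂ ℤ._+_ (ℤ.*-distribˡ-+ (a zero) (+ c zero) (+ d zero)) (wsum-+ (a ∘ suc) (c ∘ suc) (d ∘ suc)))
  (interchange (a zero ℤ.* + c zero) (a zero ℤ.* + d zero)
               (wsum (a ∘ suc) (c ∘ suc)) (wsum (a ∘ suc) (d ∘ suc)))

wsum-zeroˡ : ∀ {n} (c : Config n) → wsum (const 0ℤ) c ≡ 0ℤ
wsum-zeroˡ {zero}  c = refl
wsum-zeroˡ {suc n} c = trans (ℤ.+-identityˡ _) (wsum-zeroˡ (c ∘ suc))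

wsum-zeroʳ : ∀ {n} (a : Fin n → ℤ) → wsum a (const 0) ≡ 0ℤ
wsum-zeroʳ {zero}  a = refl
wsum-zeroʳ {suc n} a = cong₂ ℤ._+_ (ℤ.*-zeroʳ (a zero)) (wsum-zeroʳ (a ∘ suc))

wsum-nonneg : ∀ {n} {a : Fin n → ℤ} → (∀ i → 0ℤ ℤ.≤ a i) → (c : Config n) → 0ℤ ℤ.≤ wsum a c
wsum-nonneg {zero}  nonneg c = +≤+ z≤n
wsum-nonneg {suc n} nonneg c =
  ℤ.+-mono-≤ (head (nonneg zero)) (wsum-nonneg (nonneg ∘ suc) (c ∘ suc))
  where
  head : ∀ {z} → 0ℤ ℤ.≤ z → 0ℤ ℤ.≤ z ℤ.* + c zero
  head (+≤+ {n = m} _) = subst (0ℤ ℤ.≤_) (ℤ.pos-* m (c zero)) (+≤+ z≤n)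

δ : ∀ {n} → Fin n → Config n
δ zero    zero    = 1
δ zero    (suc _) = 0
δ (suc _) zero    = 0
δ (suc i) (suc j) = δ i j

wsum-δ : ∀ {n} (a : Fin n → ℤ) (i : Fin n) → wsum a (δ i) ≡ a i
wsum-δ a zero    =
  trans (cong₂ ℤ._+_ (ℤ.*-identityʳ (a zero)) (wsum-zeroʳ (a ∘ suc))) (ℤ.+-identityʳ (a zero))
wsum-δ a (suc i) =
  trans (cong₂ ℤ._+_ (ℤ.*-zeroʳ (a zero)) (wsum-δ (a ∘ suc) i)) (ℤ.+-identityˡ (a (suc i)))

δ-≤ : ∀ {n} {c : Config n} i → 0 < c i → ∀ j → δ i j ≤ c j
δ-≤ zero    0<cᵢ zero    = 0<cᵢ
δ-≤ zero    0<cᵢ (suc j) = z≤n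
δ-≤ (suc i) 0<cᵢ zero    = z≤n
δ-≤ (suc i) 0<cᵢ (suc j) = δ-≤ i 0<cᵢ j

wsum-split : ∀ k {m} (a : Fin (k + m) → ℤ) (c : Config (k + m)) →
  wsum a c ≡ wsum (a ∘ (_↑ˡ m)) (c ∘ (_↑ˡ m)) ℤ.+ wsum (a ∘ (k ↑ʳ_)) (c ∘ (k ↑ʳ_))
wsum-split zero    a c = sym (ℤ.+-identityˡ _)
wsum-split (suc k) a c = trans
  (cong (ℤ._+_ (a zero ℤ.* + c zero)) (wsum-split k (a ∘ suc) (c ∘ suc)))
  (sym (ℤ.+-assoc (a zero ℤ.* + c zero) _ _))

wsum-++ : ∀ {k m} (a₁ : Fin k → ℤ) (a₂ : Fin m → ℤ) (c : Config (k + m)) →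
  wsum (a₁ ++ a₂) c ≡ wsum a₁ (c ∘ (_↑ˡ m)) ℤ.+ wsum a₂ (c ∘ (k ↑ʳ_))
wsum-++ {k} a₁ a₂ c = trans (wsum-split k (a₁ ++ a₂) c)
  (cong₂ ℤ._+_ (wsum-cong (lookup-++ˡ a₁ a₂) λ _ → refl) (wsum-cong (lookup-++ʳ a₁ a₂) λ _ → refl))

wsum-++-++ : ∀ {k m} (a₁ : Fin k → ℤ) (a₂ : Fin m → ℤ) (c₁ : Config k) (c₂ : Config m) →
  wsum (a₁ ++ a₂) (c₁ ++ c₂) ≡ wsum a₁ c₁ ℤ.+ wsum a₂ c₂
wsum-++-++ a₁ a₂ c₁ c₂ = trans (wsum-++ a₁ a₂ (c₁ ++ c₂))
  (cong₂ ℤ._+_ (wsum-cong (λ _ → refl) (lookup-++ˡ c₁ c₂)) (wsum-cong (λ _ → refl) (lookup-++ʳ c₁ c₂)))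

++-≤ : ∀ {k m} {u₁ : Config k} {u₂ : Config m} (c : Config (k + m)) →
  (∀ i → u₁ i ≤ c (i ↑ˡ m)) → (∀ j → u₂ j ≤ c (k ↑ʳ j)) → ∀ s → (u₁ ++ u₂) s ≤ c s
++-≤ {k} c ≤₁ ≤₂ s with splitAt k s in eq
... | inj₁ i = subst (_ ≤_) (cong c (splitAt⁻¹-↑ˡ eq)) (≤₁ i)
... | inj₂ j = subst (_ ≤_) (cong c (splitAt⁻¹-↑ʳ eq)) (≤₂ j)

initial-++ : ∀ {k} (D : CRD k) (x : Fin k → ℕ) → initial D x ≗ x ++ context D
initial-++ {k} D x s with splitAt k s
... | inj₁ _ = refl
... | inj₂ _ = refl

wsum-initial : ∀ {k} (D : CRD k) (a₁ : Fin k → ℤ) (a₂ : Fin (m D) → ℤ) (x : Fin k → ℕ) →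
  wsum (a₁ ++ a₂) (initial D x) ≡ wsum a₁ x ℤ.+ wsum a₂ (context D)
wsum-initial D a₁ a₂ x =
  trans (wsum-cong (λ _ → refl) (initial-++ D x)) (wsum-++-++ a₁ a₂ x (context D))

Conserves : ∀ {n} → (Fin n → ℤ) → Reaction n → Set
Conserves a r = wsum a (products r) ≡ wsum a (reactants r)

Decreases : ∀ {n} → (Fin n → ℤ) → Reaction n → Set
Decreases a r = wsum a (products r) ℤ.< wsum a (reactants r)

module _ {n} (a : Fin n → ℤ) (r : Reaction n) {x : Config n} where

  private
    leftover : Config n
    leftover i = x i ∸ reactants r i

  wsum-apply : wsum a (apply r x) ≡ wsum a leftover ℤ.+ wsum a (products r)
  wsum-apply = wsum-+ a leftover (products r)

  wsum-applicable : Applicable r x → wsum a x ≡ wsum a leftover ℤ.+ wsum a (reactants r)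
  wsum-applicable app =
    trans (wsum-cong (λ _ → refl) (λ i → sym (m∸n+n≡m (app i)))) (wsum-+ a leftover (reactants r))

  apply-conserves : Conserves a r → Applicable r x → wsum a (apply r x) ≡ wsum a x
  apply-conserves conserves app =
    trans wsum-apply (trans (cong (ℤ._+_ (wsum a leftover)) conserves) (sym (wsum-applicable app)))

  apply-decreases : Decreases a r → Applicable r x → wsum a (apply r x) ℤ.< wsum a x
  apply-decreases decreases app = subst₂ ℤ._<_ (sym wsum-apply) (sym (wsum-applicable app))
    (ℤ.+-monoʳ-< (wsum a leftover) decreases)

biReach-conserves : ∀ {n} {R : List (Reaction n)} (a : Fin n → ℤ) → All (Conserves a) R →
  ∀ {x y} → BiReach R x y → wsum a y ≡ wsum a x
biReach-conserves a conserved ε              = refl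
biReach-conserves a conserved (step ◅ steps) =
  trans (biReach-conserves a conserved steps) (conserves step)
  where
  conserves : ∀ {x y} → BiStep _ x y → wsum a y ≡ wsum a x
  conserves (inj₁ (r , r∈R , app , refl)) =
    apply-conserves a r (All.lookup conserved r∈R) app
  conserves (inj₂ (r , r∈R , app , refl)) =
    apply-conserves a (reverseR r) (sym (All.lookup conserved r∈R)) app

Terminal : ∀ {n} → List (Reaction n) → Config n → Set
Terminal R o = All (λ r → ¬ Applicable r o) R

applicable? : ∀ {n} (r : Reaction n) (x : Config n) → Dec (Applicable r x)
applicable? r x = all? (λ i → reactants r i ≤? x i)

step-or-terminal : ∀ {n} (R : List (Reaction n)) (x : Config n) →
  (∃[ y ] Step R x y) ⊎ Terminal R x
step-or-terminal R x with any? (λ r → applicable? r x) R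
... | yes some = let r , r∈R , app = find some in inj₁ (apply r x , r , r∈R , app , refl)
... | no none  = inj₂ (¬Any⇒All¬ R none)

measure⇒terminal-reachable : ∀ {n} {R : List (Reaction n)} (μ : Config n → ℕ) →
  (∀ {x y} → Step R x y → μ y < μ x) → ∀ x → ∃[ o ] Reach R x o × Terminal R o
measure⇒terminal-reachable {R = R} μ decreasing x = go x (<-wellFounded (μ x))
  where
  go : ∀ x → Acc _<_ (μ x) → ∃[ o ] Reach R x o × Terminal R o
  go x (acc smaller) with step-or-terminal R x
  ... | inj₂ terminal  = x , ε , terminal
  ... | inj₁ (y , x→y) =
    let o , y→o , terminal = go y (smaller (decreasing x→y)) in o , x→y ◅ y→o , terminal

potential⇒terminal-reachable : ∀ {n} {R : List (Reaction n)} (a : Fin n → ℤ) →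
  (∀ i → 0ℤ ℤ.≤ a i) → All (Decreases a) R → ∀ x → ∃[ o ] Reach R x o × Terminal R o
potential⇒terminal-reachable a nonneg decreasing =
  measure⇒terminal-reachable (∣_∣ ∘ wsum a) step-decreases
  where
  +∣wsum∣ : ∀ c → + ∣ wsum a c ∣ ≡ wsum a c
  +∣wsum∣ c = ℤ.0≤i⇒+∣i∣≡i (wsum-nonneg nonneg c)
  step-decreases : ∀ {x y} → Step _ x y → ∣ wsum a y ∣ < ∣ wsum a x ∣
  step-decreases {x} (r , r∈R , app , refl) = ℤ.drop‿+<+
    (subst₂ ℤ._<_ (sym (+∣wsum∣ (apply r x))) (sym (+∣wsum∣ x))
            (apply-decreases a r (All.lookup decreasing r∈R) app))

terminal-stable : ∀ {k} (D : CRD k) {o} (b : Bool) →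
  Terminal (reactions D) o → Out D o b → StableOut D o b
terminal-stable D b terminal out _ ε                         = out
terminal-stable D b terminal out _ ((r , r∈R , app , _) ◅ _) = ⊥-elim (All.lookup terminal r∈R app)

terminal-reachable⇒decides : ∀ {k} (D : CRD k) {S : (Fin k → ℕ) → Set} →
  (∀ x c → BiReach (reactions D) (initial D x) c →
    ∃[ o ] Reach (reactions D) c o × Terminal (reactions D) o
           × ((S x × Out D o true) ⊎ (¬ S x × Out D o false))) →
  ReverseRobustlyDecides D S
terminal-reachable⇒decides D reach x c x↬c with reach x c x↬c
... | o , c→o , terminal , inj₁ (s , out) =
  (λ _ → o , c→o , terminal-stable D true terminal out) , (λ ¬s → contradiction s ¬s)
... | o , c→o , terminal , inj₂ (¬s , out) =
  (λ s → contradiction s ¬s) , (λ _ → o , c→o , terminal-stable D false terminal out)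

singleton-absent : ∀ {n} {c : Config n} {v : Fin n} →
  c v ≡ 0 → ∀ s → does (s ≟ v) ≡ true → c s ≡ 0
singleton-absent {v = v} cᵥ≡0 s with s ≟ v
... | yes refl = λ _ → cᵥ≡0
... | no  _    = λ ()

m+n≡1-cases : ∀ m {n} → m + n ≡ 1 → (m ≡ 1 × n ≡ 0) ⊎ (m ≡ 0 × n ≡ 1)
m+n≡1-cases zero          refl = inj₂ (refl , refl)
m+n≡1-cases (suc zero)    refl = inj₁ (refl , refl)
m+n≡1-cases (suc (suc m)) ()

pattern Lʸ  = zero
pattern Lⁿ  = suc zero
pattern Pos = suc (suc zero)
pattern Neg = suc (suc (suc zero))

module ThresholdCRD {k : ℕ} (w : Fin k → ℤ) (t : ℤ) where

  aux : Config 4 → Config (k + 4)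
  aux u = const 0 ++ u

  aux-≤ : ∀ {u o} → (∀ j → u j ≤ o (k ↑ʳ j)) → ∀ s → aux u s ≤ o s
  aux-≤ {o = o} = ++-≤ o (λ _ → z≤n)

  charge : ℤ → Config 4
  charge (+ n)    = λ { Pos → n ; _ → 0 }
  charge -[1+ n ] = λ { Neg → suc n ; _ → 0 }

  input : Fin k → Reaction (k + 4)
  input i = rxn (δ (i ↑ˡ 4)) (aux (charge (w i)))

  convert : (ℓ u ℓ′ : Fin 4) → Reaction (k + 4)
  convert ℓ u ℓ′ = rxn (aux (λ j → δ ℓ j + δ u j)) (aux (δ ℓ′))

  network : List (Reaction (k + 4))
  network = List.tabulate input List.++ convert Lʸ Neg Lⁿ ∷ convert Lⁿ Pos Lʸ ∷ []

  crd : CRD k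
  crd = record
    { m         = 4
    ; reactions = network
    ; yes       = λ s → does (s ≟ k ↑ʳ Lʸ)
    ; no        = λ s → does (s ≟ k ↑ʳ Lⁿ)
    ; context   = λ j → δ Lʸ j + charge (ℤ.- t) j
    }

  network-respects : (_∼_ : ℤ → ℤ → Set) {a₁ : Fin k → ℤ} {a₂ : Fin 4 → ℤ} →
    (∀ i → wsum a₂ (charge (w i)) ∼ a₁ i) →
    a₂ Lⁿ ∼ (a₂ Lʸ ℤ.+ a₂ Neg) → a₂ Lʸ ∼ (a₂ Lⁿ ℤ.+ a₂ Pos) →
    All (λ r → wsum (a₁ ++ a₂) (products r) ∼ wsum (a₁ ++ a₂) (reactants r)) network
  network-respects _∼_ {a₁} {a₂} inputs Lʸ→Lⁿ Lⁿ→Lʸ =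
    ++⁺ (tabulate⁺ λ i → subst₂ _∼_ (sym (wsum-aux (charge (w i)))) (sym (wsum-input i)) (inputs i))
        (converts Lʸ→Lⁿ ∷ converts Lⁿ→Lʸ ∷ [])
    where
    wsum-aux : ∀ u → wsum (a₁ ++ a₂) (aux u) ≡ wsum a₂ u
    wsum-aux u = trans (wsum-++-++ a₁ a₂ (const 0) u)
      (trans (cong (ℤ._+ wsum a₂ u) (wsum-zeroʳ a₁)) (ℤ.+-identityˡ _))
    wsum-input : ∀ i → wsum (a₁ ++ a₂) (δ (i ↑ˡ 4)) ≡ a₁ i
    wsum-input i = trans (wsum-δ (a₁ ++ a₂) (i ↑ˡ 4)) (lookup-++ˡ a₁ a₂ i)
    converts : ∀ {ℓ u ℓ′} → a₂ ℓ′ ∼ (a₂ ℓ ℤ.+ a₂ u) →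
      wsum (a₁ ++ a₂) (products (convert ℓ u ℓ′)) ∼ wsum (a₁ ++ a₂) (reactants (convert ℓ u ℓ′))
    converts {ℓ} {u} {ℓ′} = subst₂ _∼_
      (sym (trans (wsum-aux (δ ℓ′)) (wsum-δ a₂ ℓ′)))
      (sym (trans (wsum-aux _) (trans (wsum-+ a₂ (δ ℓ) (δ u)) (cong₂ ℤ._+_ (wsum-δ a₂ ℓ) (wsum-δ a₂ u)))))

  leadersᵃ valueᵃ potentialᵃ : Fin 4 → ℤ
  leadersᵃ Lʸ  = 1ℤ
  leadersᵃ Lⁿ  = 1ℤ
  leadersᵃ Pos = 0ℤ
  leadersᵃ Neg = 0ℤ
  valueᵃ Lʸ  = 0ℤ
  valueᵃ Lⁿ  = -1ℤ
  valueᵃ Pos = 1ℤ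
  valueᵃ Neg = -1ℤ
  potentialᵃ Lʸ  = 0ℤ
  potentialᵃ Lⁿ  = 0ℤ
  potentialᵃ Pos = 1ℤ
  potentialᵃ Neg = 1ℤ

  leaders value potential : Fin (k + 4) → ℤ
  leaders   = const 0ℤ ++ leadersᵃ
  value     = w ++ valueᵃ
  potential = (λ i → + suc ∣ w i ∣) ++ potentialᵃ

  leadersᵃ-sum : ∀ c → wsum leadersᵃ c ≡ + c Lʸ ℤ.+ + c Lⁿ
  leadersᵃ-sum c = ring (+ c Lʸ) (+ c Lⁿ) (+ c Pos) (+ c Neg)
    where
    ring : ∀ y n p q → 1ℤ ℤ.* y ℤ.+ (1ℤ ℤ.* n ℤ.+ (0ℤ ℤ.* p ℤ.+ (0ℤ ℤ.* q ℤ.+ 0ℤ))) ≡ y ℤ.+ n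
    ring = solve-∀

  valueᵃ-sum : ∀ c → wsum valueᵃ c ≡ + c Pos ℤ.- (+ c Lⁿ ℤ.+ + c Neg)
  valueᵃ-sum c = ring (+ c Lʸ) (+ c Lⁿ) (+ c Pos) (+ c Neg)
    where
    ring : ∀ y n p q →
      0ℤ ℤ.* y ℤ.+ (-1ℤ ℤ.* n ℤ.+ (1ℤ ℤ.* p ℤ.+ (-1ℤ ℤ.* q ℤ.+ 0ℤ))) ≡ p ℤ.- (n ℤ.+ q)
    ring = solve-∀

  potentialᵃ-sum : ∀ c → wsum potentialᵃ c ≡ + c Pos ℤ.+ + c Neg
  potentialᵃ-sum c = ring (+ c Lʸ) (+ c Lⁿ) (+ c Pos) (+ c Neg)
    where
    ring : ∀ y n p q → 0ℤ ℤ.* y ℤ.+ (0ℤ ℤ.* n ℤ.+ (1ℤ ℤ.* p ℤ.+ (1ℤ ℤ.* q ℤ.+ 0ℤ))) ≡ p ℤ.+ q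
    ring = solve-∀

  leadersᵃ-charge : ∀ z → wsum leadersᵃ (charge z) ≡ 0ℤ
  leadersᵃ-charge (+ _)    = refl
  leadersᵃ-charge -[1+ _ ] = refl

  valueᵃ-charge : ∀ z → wsum valueᵃ (charge z) ≡ z
  valueᵃ-charge (+ n)    = trans (valueᵃ-sum (charge (+ n))) (ℤ.+-identityʳ (+ n))
  valueᵃ-charge -[1+ n ] = valueᵃ-sum (charge -[1+ n ])

  potentialᵃ-charge : ∀ z → wsum potentialᵃ (charge z) ≡ + ∣ z ∣
  potentialᵃ-charge (+ n)    = trans (potentialᵃ-sum (charge (+ n))) (ℤ.+-identityʳ (+ n))
  potentialᵃ-charge -[1+ n ] = potentialᵃ-sum (charge -[1+ n ])

  leaders-conserved : All (Conserves leaders) network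
  leaders-conserved = network-respects _≡_ (leadersᵃ-charge ∘ w) refl refl

  value-conserved : All (Conserves value) network
  value-conserved = network-respects _≡_ (valueᵃ-charge ∘ w) refl refl

  potential-decreases : All (Decreases potential) network
  potential-decreases = network-respects ℤ._<_
    (λ i → subst (ℤ._< _) (sym (potentialᵃ-charge (w i))) (+<+ (n<1+n _))) (+<+ z<s) (+<+ z<s)

  potential-nonneg : ∀ s → 0ℤ ℤ.≤ potential s
  potential-nonneg s with splitAt k s
  ... | inj₁ _   = +≤+ z≤n
  ... | inj₂ Lʸ  = +≤+ z≤n
  ... | inj₂ Lⁿ  = +≤+ z≤n
  ... | inj₂ Pos = +≤+ z≤n
  ... | inj₂ Neg = +≤+ z≤n

  leaders-initial : ∀ x → wsum leaders (initial crd x) ≡ 1ℤ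
  leaders-initial x = begin
    wsum leaders (initial crd x)
      ≡⟨ wsum-initial crd (const 0ℤ) leadersᵃ x ⟩
    wsum (const 0ℤ) x ℤ.+ wsum leadersᵃ (context crd)
      ≡⟨ cong₂ ℤ._+_ (wsum-zeroˡ x) (wsum-+ leadersᵃ (δ Lʸ) (charge (ℤ.- t))) ⟩
    0ℤ ℤ.+ (1ℤ ℤ.+ wsum leadersᵃ (charge (ℤ.- t)))
      ≡⟨ cong (λ b → 0ℤ ℤ.+ (1ℤ ℤ.+ b)) (leadersᵃ-charge (ℤ.- t)) ⟩
    1ℤ ∎
    where open ≡-Reasoning

  value-initial : ∀ x → wsum value (initial crd x) ≡ wsum w x ℤ.- t
  value-initial x = begin
    wsum value (initial crd x)
      ≡⟨ wsum-initial crd w valueᵃ x ⟩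
    wsum w x ℤ.+ wsum valueᵃ (context crd)
      ≡⟨ cong (ℤ._+_ (wsum w x)) (wsum-+ valueᵃ (δ Lʸ) (charge (ℤ.- t))) ⟩
    wsum w x ℤ.+ (0ℤ ℤ.+ wsum valueᵃ (charge (ℤ.- t)))
      ≡⟨ cong (ℤ._+_ (wsum w x)) (trans (ℤ.+-identityˡ _) (valueᵃ-charge (ℤ.- t))) ⟩
    wsum w x ℤ.- t ∎
    where open ≡-Reasoning

  out-yes : ∀ {o} → 0 < o (k ↑ʳ Lʸ) → o (k ↑ʳ Lⁿ) ≡ 0 → Out crd o true
  out-yes 0<y n≡0 = (k ↑ʳ Lʸ , dec-true (k ↑ʳ Lʸ ≟ k ↑ʳ Lʸ) refl , 0<y) , singleton-absent n≡0

  out-no : ∀ {o} → 0 < o (k ↑ʳ Lⁿ) → o (k ↑ʳ Lʸ) ≡ 0 → Out crd o false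
  out-no 0<n y≡0 = (k ↑ʳ Lⁿ , dec-true (k ↑ʳ Lⁿ ≟ k ↑ʳ Lⁿ) refl , 0<n) , singleton-absent y≡0

  module _ {o : Config (k + 4)} (terminal : Terminal network o) where

    private
      converts-blocked : All (λ r → ¬ Applicable r o) (convert Lʸ Neg Lⁿ ∷ convert Lⁿ Pos Lʸ ∷ [])
      converts-blocked = ++⁻ʳ (List.tabulate input) terminal

    inputs-exhausted : ∀ i → o (i ↑ˡ 4) ≡ 0
    inputs-exhausted i = n≤0⇒n≡0 (≮⇒≥ λ 0<xᵢ →
      tabulate⁻ (++⁻ˡ (List.tabulate input) terminal) i (δ-≤ (i ↑ˡ 4) 0<xᵢ))

    Neg-absent : 0 < o (k ↑ʳ Lʸ) → o (k ↑ʳ Neg) ≡ 0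
    Neg-absent 0<y = n≤0⇒n≡0 (≮⇒≥ λ 0<neg → All.head converts-blocked
      (aux-≤ λ { Lʸ → 0<y ; Lⁿ → z≤n ; Pos → z≤n ; Neg → 0<neg }))

    Pos-absent : 0 < o (k ↑ʳ Lⁿ) → o (k ↑ʳ Pos) ≡ 0
    Pos-absent 0<n = n≤0⇒n≡0 (≮⇒≥ λ 0<pos → All.head (All.tail converts-blocked)
      (aux-≤ λ { Lʸ → z≤n ; Lⁿ → 0<n ; Pos → 0<pos ; Neg → z≤n }))

    wsum-terminal : ∀ (a₁ : Fin k → ℤ) a₂ → wsum (a₁ ++ a₂) o ≡ wsum a₂ (o ∘ (k ↑ʳ_))
    wsum-terminal a₁ a₂ = trans (wsum-++ a₁ a₂ o) (trans
      (cong (ℤ._+ _) (trans (wsum-cong (λ _ → refl) inputs-exhausted) (wsum-zeroʳ a₁)))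
      (ℤ.+-identityˡ _))

    leader-count : wsum leaders o ≡ 1ℤ → o (k ↑ʳ Lʸ) + o (k ↑ʳ Lⁿ) ≡ 1
    leader-count one =
      ℤ.+-injective (trans (sym (leadersᵃ-sum (o ∘ (k ↑ʳ_)))) (trans (sym (wsum-terminal _ _)) one))

    value-terminal : wsum value o ≡ + o (k ↑ʳ Pos) ℤ.- (+ o (k ↑ʳ Lⁿ) ℤ.+ + o (k ↑ʳ Neg))
    value-terminal = trans (wsum-terminal w valueᵃ) (valueᵃ-sum (o ∘ (k ↑ʳ_)))

    terminal-output : ∀ {x} → wsum leaders o ≡ 1ℤ → wsum value o ≡ wsum w x ℤ.- t →
      (Threshold w t x × Out crd o true) ⊎ (¬ Threshold w t x × Out crd o false)
    terminal-output {x} one value≡ with m+n≡1-cases (o (k ↑ʳ Lʸ)) (leader-count one)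
    ... | inj₁ (y≡1 , n≡0) =
      inj₁ (ℤ.0≤i-j⇒j≤i (subst (0ℤ ℤ.≤_) pos≡ (+≤+ z≤n)) , out-yes 0<y n≡0)
      where
      0<y : 0 < o (k ↑ʳ Lʸ)
      0<y = subst (0 <_) (sym y≡1) z<s
      pos≡ : + o (k ↑ʳ Pos) ℤ.- (+ 0 ℤ.+ + 0) ≡ wsum w x ℤ.- t
      pos≡ = trans (cong₂ (λ a b → + o (k ↑ʳ Pos) ℤ.- (+ a ℤ.+ + b)) (sym n≡0) (sym (Neg-absent 0<y)))
                   (trans (sym value-terminal) value≡)
    ... | inj₂ (y≡0 , n≡1) =
      inj₂ ((λ t≤s → ℤ.≤⇒≯ (ℤ.i≤j⇒0≤j-i t≤s) (subst (ℤ._< 0ℤ) neg≡ -<+)) , out-no 0<n y≡0)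
      where
      0<n : 0 < o (k ↑ʳ Lⁿ)
      0<n = subst (0 <_) (sym n≡1) z<s
      neg≡ : + 0 ℤ.- (+ 1 ℤ.+ + o (k ↑ʳ Neg)) ≡ wsum w x ℤ.- t
      neg≡ = trans (cong₂ (λ p a → + p ℤ.- (+ a ℤ.+ + o (k ↑ʳ Neg))) (sym (Pos-absent 0<n)) (sym n≡1))
                   (trans (sym value-terminal) value≡)

  decides : ReverseRobustlyDecides crd (Threshold w t)
  decides = terminal-reachable⇒decides crd λ x c x↬c →
    let o , c→o , terminal = potential⇒terminal-reachable potential potential-nonneg potential-decreases c
        x↬o = x↬c ◅◅ Star.map inj₁ c→o
    in o , c→o , terminal , terminal-output terminal
         (trans (biReach-conserves leaders leaders-conserved x↬o) (leaders-initial x))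
         (trans (biReach-conserves value value-conserved x↬o) (value-initial x))

lemma8 : (k : ℕ) (w : Fin k → ℤ) (t : ℤ) → ReverseRobustlyDecidable k (Threshold w t)
lemma8 k w t = crd , decides
  where open ThresholdCRD w t
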